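{- Let $G$ be a König–Egerváry graph. Then: (i) $|\mathrm{corona}(G)|+|\mathrm{core}(G)|=2\alpha(G)$; (ii) $\mathrm{diadem}(G)=\mathrm{corona}(G)$; moreover, the inclusion $\mathrm{diadem}(H)\subseteq\mathrm{corona}(H)$ holds for every graph $H$; (iii) $|\ker(G)|+|\mathrm{diadem}(G)|\leq 2\alpha(G)$.
   Context: Graphs are finite and simple. For $X\subseteq V(G)$, $N(X)=\{v\in V(G):N(v)\cap X\neq\emptyset\}$ and $d(X)=|X|-|N(X)|$. An independent set $A$ is a critical independent set if $d(A)=\max\{d(I):I\text{ independent in }G\}$. $\alpha(G)$ is the independence number, $\mu(G)$ the size of a maximum matching, $\Omega(G)$ the family of maximum independent sets; $\mathrm{core}(G)=\bigcap\{S:S\in\Omega(G)\}$, $\mathrm{corona}(G)=\bigcup\{S:S\in\Omega(G)\}$, $\ker(G)=\bigcap\{S: S\text{ is a critical independent set}\}$, $\mathrm{diadem}(G)=\bigcup\{S:S\text{ is a critical independent set}\}$. $G$ is a König–Egerváry graph if $\alpha(G)+\mu(G)=|V(G)|$. -}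

module Defs where

open import Data.Nat using (ℕ; zero; suc; _+_; _≤_)
open import Data.Integer as ℤ using (ℤ; _-_)
open import Data.Bool using (Bool; true; false; _∧_; _∨_)
open import Data.Fin using (Fin; zero; suc)
open import Data.Fin.Subset using (Subset; _∈_; ∣_∣; inside; outside)
open import Data.Vec using (Vec; tabulate; lookup)
open import Data.List using (List; length; concatMap; _∷_; [])
open import Data.List.Relation.Unary.All using (All)
open import Data.List.Relation.Unary.Unique.Propositional using (Unique)
open import Data.Product using (Σ; _×_; _,_; ∃)
open import Relation.Binary.PropositionalEquality using (_≡_)

record Graph (n : ℕ) : Set where
  field
    adj    : Fin n → Fin n → Bool
    adj-sym : ∀ u v → adj u v ≡ adj v u
    adj-irr : ∀ v → adj v v ≡ false
open Graph public

anyFin : ∀ {n} → (Fin n → Bool) → Bool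
anyFin {zero}  p = false
anyFin {suc n} p = p zero ∨ anyFin (λ i → p (suc i))

infix 3 _↔ₚ_
_↔ₚ_ : Set → Set → Set
P ↔ₚ Q = (P → Q) × (Q → P)

module _ {n : ℕ} (G : Graph n) where

  N : Subset n → Subset n
  N X = tabulate λ v → anyFin (λ u → lookup X u ∧ adj G v u)

  d : Subset n → ℤ
  d X = ℤ.+ ∣ X ∣ - ℤ.+ ∣ N X ∣

  Independent : Subset n → Set
  Independent S = ∀ u v → u ∈ S → v ∈ S → adj G u v ≡ false

  MaximumIndependent : Subset n → Set
  MaximumIndependent S =
    Independent S × (∀ T → Independent T → ∣ T ∣ ≤ ∣ S ∣)

  IsAlpha : ℕ → Set
  IsAlpha a = Σ (Subset n) λ S → MaximumIndependent S × ∣ S ∣ ≡ a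

  endpoints : List (Fin n × Fin n) → List (Fin n)
  endpoints = concatMap (λ { (u , v) → u ∷ v ∷ [] })

  Matching : List (Fin n × Fin n) → Set
  Matching M = All (λ { (u , v) → adj G u v ≡ true }) M × Unique (endpoints M)

  IsMu : ℕ → Set
  IsMu m = Σ (List (Fin n × Fin n)) λ M → Matching M × length M ≡ m
           × (∀ M' → Matching M' → length M' ≤ m)

  KonigEgervary : Set
  KonigEgervary = Σ ℕ λ a → Σ ℕ λ m → IsAlpha a × IsMu m × a + m ≡ n

  CriticalIndependent : Subset n → Set
  CriticalIndependent A =
    Independent A × (∀ I → Independent I → d I ℤ.≤ d A)

  IsCore IsCorona IsKer IsDiadem : Subset n → Set
  IsCore   C = ∀ v → v ∈ C ↔ₚ (∀ S → MaximumIndependent S → v ∈ S)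
  IsCorona C = ∀ v → v ∈ C ↔ₚ (∃ λ S → MaximumIndependent S × v ∈ S)
  IsKer    C = ∀ v → v ∈ C ↔ₚ (∀ S → CriticalIndependent S → v ∈ S)
  IsDiadem C = ∀ v → v ∈ C ↔ₚ (∃ λ S → CriticalIndependent S × v ∈ S)

module Submission where

-- Fix a matching M with α + |M| = n and count a vertex set as the number of endpoints
-- of M it contains plus the number of unmatched vertices it contains. An independent
-- set meets every edge of M at most once, so it has at most |M| + (n - 2|M|) = α
-- elements; hence a maximum independent set contains every unmatched vertex and exactly
-- one endpoint of each edge of M. If xy ∈ M and x lies in a maximum set, then either y
-- lies in some maximum set (x, y ∈ corona, neither in core) or in none (x ∈ core,
-- y ∉ corona): each edge contributes 2 to |corona| + |core|, as does each unmatched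
-- vertex, giving 2α. The same count gives d(I) ≤ α - |M| ≤ d(S) for independent I and
-- maximum S, so maximum sets are critical: corona ⊆ diadem and ker ⊆ core.
-- Conversely, in any graph, for A critical and S maximum the set A ∪ (S - N(A)) is
-- again maximum, so diadem ⊆ corona.

open import Defs
open import Data.Nat using (ℕ; zero; suc; _+_; _*_; _∸_; _≤_; z≤n; _≤?_)
open import Data.Nat.Properties
open import Data.Bool as Bool using (Bool; true; false; _∧_; if_then_else_)
open import Data.Bool.Properties using (∧-conicalˡ; ∧-conicalʳ; ¬-not)
open import Data.Fin using (Fin; zero; suc)
open import Data.Fin.Subset
  using (Subset; _∈_; _∉_; _⊆_; ∣_∣; ⊤; ⊥; ∁; _∩_; _∪_; _─_; _-_; ⁅_⁆; inside; outside)
open import Data.Fin.Subset.Properties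
open import Data.Vec using ([]; _∷_; lookup; here; there)
open import Data.Vec.Properties using ([]=⇒lookup; lookup⇒[]=; lookup∘tabulate)
open import Data.Fin.Properties using (all?)
open import Data.Sum using (inj₁; inj₂; [_,_]′)
open import Data.List using (List; []; _∷_; map; length)
open import Data.List.Relation.Unary.All as All using (All; []; _∷_)
open import Data.List.Relation.Unary.AllPairs using ([]; _∷_)
open import Data.List.Relation.Unary.Unique.Propositional using (Unique)
open import Data.Nat.ListAction using (sum)
open import Data.Nat.Tactic.RingSolver using (solve-∀)
open import Algebra.Properties.CommutativeSemigroup +-commutativeSemigroup using (interchange)
open import Data.Integer as ℤ using (_⊖_)
import Data.Integer.Properties as ℤ
open import Function.Bundles using (_⇔_; mk⇔; Equivalence)
open import Data.Product using (_×_; _,_; ∃; proj₁; proj₂)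
open import Function using (_∘_)
open import Relation.Binary.PropositionalEquality
open import Relation.Nullary using (yes; no; contradiction)
open import Relation.Nullary.Decidable using (_×-dec_; _→-dec_)
open import Relation.Unary using (Pred; Decidable)

private variable
  n : ℕ
  p q r : Subset n
  x y : Fin n

-- Opaque, so that unification can recover x and p from 𝟙[ x ∈ p ].
opaque
  𝟙[_∈_] : Fin n → Subset n → ℕ
  𝟙[ x ∈ p ] = if lookup p x then 1 else 0

opaque
  unfolding 𝟙[_∈_]

  𝟙-∈ : x ∈ p → 𝟙[ x ∈ p ] ≡ 1
  𝟙-∈ x∈p rewrite []=⇒lookup x∈p = refl

  𝟙-∉ : x ∉ p → 𝟙[ x ∈ p ] ≡ 0
  𝟙-∉ {x = x} {p = p} x∉p with lookup p x in eq
  ... | true  = contradiction (lookup⇒[]= x p eq) x∉p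
  ... | false = refl

  𝟙≤1 : 𝟙[ x ∈ p ] ≤ 1
  𝟙≤1 {x = x} {p = p} with lookup p x
  ... | true  = ≤-refl
  ... | false = z≤n

  ∣p∣≡𝟙+∣p-x∣ : ∀ (p : Subset n) x → ∣ p ∣ ≡ 𝟙[ x ∈ p ] + ∣ p - x ∣
  ∣p∣≡𝟙+∣p-x∣ (inside  ∷ p) zero    = cong (λ s → suc ∣ s ∣) (sym (p─⊥≡p p))
  ∣p∣≡𝟙+∣p-x∣ (outside ∷ p) zero    = cong ∣_∣ (sym (p─⊥≡p p))
  ∣p∣≡𝟙+∣p-x∣ (inside  ∷ p) (suc x) =
    trans (cong suc (∣p∣≡𝟙+∣p-x∣ p x)) (sym (+-suc 𝟙[ x ∈ p ] ∣ p - x ∣))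
  ∣p∣≡𝟙+∣p-x∣ (outside ∷ p) (suc x) = ∣p∣≡𝟙+∣p-x∣ p x

𝟙-mono : (x ∈ p → y ∈ q) → 𝟙[ x ∈ p ] ≤ 𝟙[ y ∈ q ]
𝟙-mono {x = x} {p = p} {y = y} {q = q} x∈p⇒y∈q with x ∈? p
... | yes x∈p = ≤-reflexive (trans (𝟙-∈ x∈p) (sym (𝟙-∈ (x∈p⇒y∈q x∈p))))
... | no  x∉p = ≤-trans (≤-reflexive (𝟙-∉ x∉p)) z≤n

𝟙[y∈p-x]≡𝟙[y∈p] : ∀ (p : Subset n) → x ≢ y → 𝟙[ y ∈ p - x ] ≡ 𝟙[ y ∈ p ]
𝟙[y∈p-x]≡𝟙[y∈p] {x = x} {y = y} p x≢y with y ∈? p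
... | yes y∈p = trans (𝟙-∈ (x∈p∧x≢y⇒x∈p-y y∈p (x≢y ∘ sym))) (sym (𝟙-∈ y∈p))
... | no  y∉p = trans (𝟙-∉ (y∉p ∘ p─q⊆p p ⁅ x ⁆)) (sym (𝟙-∉ y∉p))

∣p∣≡∣p∩q∣+∣p─q∣ : ∀ (p q : Subset n) → ∣ p ∣ ≡ ∣ p ∩ q ∣ + ∣ p ─ q ∣
∣p∣≡∣p∩q∣+∣p─q∣ []            []            = refl
∣p∣≡∣p∩q∣+∣p─q∣ (inside  ∷ p) (inside  ∷ q) = cong suc (∣p∣≡∣p∩q∣+∣p─q∣ p q)
∣p∣≡∣p∩q∣+∣p─q∣ (inside  ∷ p) (outside ∷ q) =
  trans (cong suc (∣p∣≡∣p∩q∣+∣p─q∣ p q)) (sym (+-suc ∣ p ∩ q ∣ ∣ p ─ q ∣))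
∣p∣≡∣p∩q∣+∣p─q∣ (outside ∷ p) (inside  ∷ q) = ∣p∣≡∣p∩q∣+∣p─q∣ p q
∣p∣≡∣p∩q∣+∣p─q∣ (outside ∷ p) (outside ∷ q) = ∣p∣≡∣p∩q∣+∣p─q∣ p q

∣p∪q∣≡∣p∣+∣q∣ : ∀ (p q : Subset n) → (∀ {x} → x ∈ p → x ∉ q) → ∣ p ∪ q ∣ ≡ ∣ p ∣ + ∣ q ∣
∣p∪q∣≡∣p∣+∣q∣ []            []            _        = refl
∣p∪q∣≡∣p∣+∣q∣ (inside  ∷ p) (inside  ∷ q) disjoint = contradiction here (disjoint here)
∣p∪q∣≡∣p∣+∣q∣ (inside  ∷ p) (outside ∷ q) disjoint =
  cong suc (∣p∪q∣≡∣p∣+∣q∣ p q (λ x∈p x∈q → disjoint (there x∈p) (there x∈q)))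
∣p∪q∣≡∣p∣+∣q∣ (outside ∷ p) (inside  ∷ q) disjoint =
  trans (cong suc (∣p∪q∣≡∣p∣+∣q∣ p q (λ x∈p x∈q → disjoint (there x∈p) (there x∈q))))
        (sym (+-suc ∣ p ∣ ∣ q ∣))
∣p∪q∣≡∣p∣+∣q∣ (outside ∷ p) (outside ∷ q) disjoint =
  ∣p∪q∣≡∣p∣+∣q∣ p q (λ x∈p x∈q → disjoint (there x∈p) (there x∈q))

∣p∣+∣q∣≤∣r∣ : (∀ {x} → x ∈ p → x ∉ q) → p ⊆ r → q ⊆ r → ∣ p ∣ + ∣ q ∣ ≤ ∣ r ∣
∣p∣+∣q∣≤∣r∣ {p = p} {q = q} disjoint p⊆r q⊆r = ≤-trans
  (≤-reflexive (sym (∣p∪q∣≡∣p∣+∣q∣ p q disjoint)))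
  (p⊆q⇒∣p∣≤∣q∣ λ x∈p∪q → [ p⊆r , q⊆r ]′ (x∈p∪q⁻ p q x∈p∪q))

x∈p─q⇒x∉q : ∀ (p q : Subset n) → x ∈ p ─ q → x ∉ q
x∈p─q⇒x∉q (s ∷ p) (outside ∷ q) here             ()
x∈p─q⇒x∉q (s ∷ p) (t       ∷ q) (there x∈p─q) (there x∈q) = x∈p─q⇒x∉q p q x∈p─q x∈q

p⊆q∧∣q∣≤∣p∣⇒p≡q : p ⊆ q → ∣ q ∣ ≤ ∣ p ∣ → p ≡ q
p⊆q∧∣q∣≤∣p∣⇒p≡q {p = p} {q = q} p⊆q ∣q∣≤∣p∣ = ⊆-antisym p⊆q q⊆p
  where
  q⊆p : q ⊆ p
  q⊆p {x} x∈q with x ∈? p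
  ... | yes x∈p = x∈p
  ... | no  x∉p = contradiction (p⊂q⇒∣p∣<∣q∣ (p⊆q , x , x∈q , x∉p)) (≤⇒≯ ∣q∣≤∣p∣)

∁q⊆p⇒p─q≡∁q : ∀ (p q : Subset n) → ∁ q ⊆ p → p ─ q ≡ ∁ q
∁q⊆p⇒p─q≡∁q p q ∁q⊆p = ⊆-antisym
  (x∉p⇒x∈∁p ∘ x∈p─q⇒x∉q p q)
  (λ x∈∁q → x∈p∧x∉q⇒x∈p─q (∁q⊆p x∈∁q) (x∈∁p⇒x∉p x∈∁q))

∃-maximum : ∀ {ℓ} {P : Pred (Subset n) ℓ} → Decidable P → P ⊥ →
            ∃ λ S → P S × (∀ T → P T → ∣ T ∣ ≤ ∣ S ∣)
∃-maximum {n = n} {P = P} P? P⊥ = search n (λ T _ → ∣p∣≤n T)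
  where
  search : ∀ k → (∀ T → P T → ∣ T ∣ ≤ k) → ∃ λ S → P S × (∀ T → P T → ∣ T ∣ ≤ ∣ S ∣)
  search k bound with anySubset? (λ T → P? T ×-dec (k ≤? ∣ T ∣))
  ... | yes (S , PS , k≤∣S∣) = S , PS , λ T PT → ≤-trans (bound T PT) k≤∣S∣
  search zero    _ | no none = contradiction (⊥ , P⊥ , z≤n) none
  search (suc k) _ | no none = search k λ T PT → ≤-pred (≰⇒> λ k<∣T∣ → none (T , PT , k<∣T∣))

m+o≡n+p⇒m≡n×o≡p : ∀ {m n o p} → m ≤ n → o ≤ p → m + o ≡ n + p → m ≡ n × o ≡ p
m+o≡n+p⇒m≡n×o≡p {m} {n} {o} {p} m≤n o≤p eq =
    ≤-antisym m≤n (+-cancelʳ-≤ o n m (≤-trans (+-monoʳ-≤ n o≤p) (≤-reflexive (sym eq))))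
  , ≤-antisym o≤p (+-cancelˡ-≤ m p o (≤-trans (+-monoˡ-≤ p m≤n) (≤-reflexive (sym eq))))

module _ {a} {A : Set a} {f g : A → ℕ} where

  sum-map-mono : ∀ xs → All (λ x → f x ≤ g x) xs → sum (map f xs) ≤ sum (map g xs)
  sum-map-mono []       []         = z≤n
  sum-map-mono (x ∷ xs) (fx≤gx ∷ h) = +-mono-≤ fx≤gx (sum-map-mono xs h)

  sum-map-≡⇒All-≡ : ∀ xs → All (λ x → f x ≤ g x) xs → sum (map f xs) ≡ sum (map g xs) →
                     All (λ x → f x ≡ g x) xs
  sum-map-≡⇒All-≡ []       []          _  = []
  sum-map-≡⇒All-≡ (x ∷ xs) (fx≤gx ∷ h) eq with m+o≡n+p⇒m≡n×o≡p fx≤gx (sum-map-mono xs h) eq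
  ... | fx≡gx , rest = fx≡gx ∷ sum-map-≡⇒All-≡ xs h rest

  sum-map-+ : ∀ xs → sum (map (λ x → f x + g x) xs) ≡ sum (map f xs) + sum (map g xs)
  sum-map-+ []       = refl
  sum-map-+ (x ∷ xs) = trans (cong (f x + g x +_) (sum-map-+ xs)) (interchange (f x) (g x) _ _)

sum-map-const : ∀ {a} {A : Set a} {f : A → ℕ} {c} xs → All (λ x → f x ≡ c) xs →
                sum (map f xs) ≡ length xs * c
sum-map-const []       []          = refl
sum-map-const (x ∷ xs) (fx≡c ∷ h) = cong₂ _+_ fx≡c (sum-map-const xs h)

-- Independent and critical sets

m⊖o≤n⊖o⇔m≤n : ∀ m n o → m ⊖ o ℤ.≤ n ⊖ o ⇔ m ≤ n
m⊖o≤n⊖o⇔m≤n m n o = mk⇔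
  (λ m⊖o≤n⊖o → ≮⇒≥ λ n<m → ℤ.<⇒≱ (ℤ.⊖-monoˡ-< o n<m) m⊖o≤n⊖o)
  (ℤ.⊖-monoˡ-≤ o)

+m-+n≤+o-+p⇔m+p≤o+n : ∀ m n o p → ℤ.+ m ℤ.- ℤ.+ n ℤ.≤ ℤ.+ o ℤ.- ℤ.+ p ⇔ m + p ≤ o + n
+m-+n≤+o-+p⇔m+p≤o+n m n o p =
  subst₂ (λ i j → i ℤ.≤ j ⇔ m + p ≤ o + n) (sym lhs) (sym rhs)
    (subst₂ (λ a b → (p + m) ⊖ (n + p) ℤ.≤ (n + o) ⊖ (n + p) ⇔ a ≤ b) (+-comm p m) (+-comm n o)
      (m⊖o≤n⊖o⇔m≤n (p + m) (n + o) (n + p)))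
  where
  lhs : ℤ.+ m ℤ.- ℤ.+ n ≡ (p + m) ⊖ (n + p)
  lhs = trans (ℤ.[+m]-[+n]≡m⊖n m n)
              (trans (sym (ℤ.+-cancelˡ-⊖ p m n)) (cong ((p + m) ⊖_) (+-comm p n)))
  rhs : ℤ.+ o ℤ.- ℤ.+ p ≡ (n + o) ⊖ (n + p)
  rhs = trans (ℤ.[+m]-[+n]≡m⊖n o p) (sym (ℤ.+-cancelˡ-⊖ n o p))

anyFin≡true⇒∃ : ∀ {n} (P : Fin n → Bool) → anyFin P ≡ true → ∃ λ i → P i ≡ true
anyFin≡true⇒∃ {suc n} P any with P zero in P0
... | true  = zero , P0
... | false with anyFin≡true⇒∃ (P ∘ suc) any
...   | i , Pi = suc i , Pi

∃⇒anyFin≡true : ∀ {n} (P : Fin n → Bool) i → P i ≡ true → anyFin P ≡ true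
∃⇒anyFin≡true P zero    Pi rewrite Pi = refl
∃⇒anyFin≡true P (suc i) Pi with P zero
... | true  = refl
... | false = ∃⇒anyFin≡true (P ∘ suc) i Pi

module _ (G : Graph n) where

  private variable
    u v : Fin n
    A S S′ X X′ : Subset n

  ∈N⁺ : u ∈ X → adj G v u ≡ true → v ∈ N G X
  ∈N⁺ {u} {X} {v} u∈X vu = lookup⇒[]= v (N G X)
    (trans (lookup∘tabulate _ v) (∃⇒anyFin≡true _ u (cong₂ _∧_ ([]=⇒lookup u∈X) vu)))

  ∈N⁻ : v ∈ N G X → ∃ λ u → u ∈ X × adj G v u ≡ true
  ∈N⁻ {v} {X} v∈NX with anyFin≡true⇒∃ _ (trans (sym (lookup∘tabulate _ v)) ([]=⇒lookup v∈NX))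
  ... | u , Xu∧vu = u , lookup⇒[]= u X (∧-conicalˡ _ _ Xu∧vu) , ∧-conicalʳ _ _ Xu∧vu

  N-mono : X ⊆ X′ → N G X ⊆ N G X′
  N-mono X⊆X′ v∈NX with ∈N⁻ v∈NX
  ... | u , u∈X , vu = ∈N⁺ (X⊆X′ u∈X) vu

  Independent-⊆ : X ⊆ X′ → Independent G X′ → Independent G X
  Independent-⊆ X⊆X′ indX′ u v u∈X v∈X = indX′ u v (X⊆X′ u∈X) (X⊆X′ v∈X)

  Independent⇒adj≢true : Independent G A → u ∈ A → v ∈ A → adj G u v ≢ true
  Independent⇒adj≢true indA u∈A v∈A uv = contradiction (trans (sym uv) (indA _ _ u∈A v∈A)) λ ()

  Independent⇒∉N : Independent G A → v ∈ A → v ∉ N G A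
  Independent⇒∉N indA v∈A v∈NA with ∈N⁻ v∈NA
  ... | u , u∈A , vu = Independent⇒adj≢true indA v∈A u∈A vu

  Independent-∪ : Independent G X → Independent G X′ →
                  (∀ u v → u ∈ X → v ∈ X′ → adj G u v ≡ false) → Independent G (X ∪ X′)
  Independent-∪ {X} {X′} indX indX′ cross u v u∈X∪X′ v∈X∪X′
    with x∈p∪q⁻ X X′ u∈X∪X′ | x∈p∪q⁻ X X′ v∈X∪X′
  ... | inj₁ u∈X | inj₁ v∈X = indX u v u∈X v∈X
  ... | inj₁ u∈X | inj₂ v∈X′ = cross u v u∈X v∈X′
  ... | inj₂ u∈X′ | inj₁ v∈X = trans (adj-sym G u v) (cross v u v∈X u∈X′)
  ... | inj₂ u∈X′ | inj₂ v∈X′ = indX′ u v u∈X′ v∈X′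

  Independent? : Decidable (Independent G)
  Independent? S = all? λ u → all? λ v →
    (u ∈? S) →-dec ((v ∈? S) →-dec (adj G u v Bool.≟ false))

  maximumIndependent : ∃ (MaximumIndependent G)
  maximumIndependent = ∃-maximum Independent? (λ _ _ u∈⊥ → contradiction u∈⊥ ∉⊥)

  ∣maximum∣≡∣maximum∣ : MaximumIndependent G S → MaximumIndependent G S′ → ∣ S ∣ ≡ ∣ S′ ∣
  ∣maximum∣≡∣maximum∣ (indS , maxS) (indS′ , maxS′) = ≤-antisym (maxS′ _ indS) (maxS _ indS′)

  d≤d⇔ : ∀ X X′ → d G X ℤ.≤ d G X′ ⇔ ∣ X ∣ + ∣ N G X′ ∣ ≤ ∣ X′ ∣ + ∣ N G X ∣
  d≤d⇔ X X′ = +m-+n≤+o-+p⇔m+p≤o+n (∣ X ∣) (∣ N G X ∣) (∣ X′ ∣) (∣ N G X′ ∣)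

  -- With Y = S ∩ N(A), comparing d(A) with d(A ─ N(Y)) shows ∣Y∣ ≤ ∣A ─ S∣,
  -- so trading Y for A ─ S does not shrink S.
  critical∪maximum─N : CriticalIndependent G A → MaximumIndependent G S →
                       MaximumIndependent G (A ∪ (S ─ N G A))
  critical∪maximum─N {A} {S} (indA , critA) (indS , maxS) =
    indT , λ R indR → ≤-trans (maxS R indR) ∣S∣≤∣T∣
    where
    T Y A′ : Subset n
    T  = A ∪ (S ─ N G A)
    Y  = S ∩ N G A
    A′ = A ─ N G Y

    indT : Independent G T
    indT = Independent-∪ indA (Independent-⊆ (p─q⊆p S _) indS) λ u v u∈A v∈S─NA →
      ¬-not λ uv → x∈p─q⇒x∉q S _ v∈S─NA (∈N⁺ u∈A (trans (adj-sym G v u) uv))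

    NA′∩Y≡∅ : ∀ {v} → v ∈ N G A′ → v ∉ Y
    NA′∩Y≡∅ {v} v∈NA′ v∈Y with ∈N⁻ v∈NA′
    ... | u , u∈A′ , vu = x∈p─q⇒x∉q A _ u∈A′ (∈N⁺ v∈Y (trans (adj-sym G u v) vu))

    A∩NY⊆A─S : A ∩ N G Y ⊆ A ─ S
    A∩NY⊆A─S u∈A∩NY with x∈p∩q⁻ A _ u∈A∩NY
    ... | u∈A , u∈NY with ∈N⁻ u∈NY
    ...   | w , w∈Y , uw = x∈p∧x∉q⇒x∈p─q u∈A λ u∈S →
      Independent⇒adj≢true indS u∈S (p∩q⊆p S _ w∈Y) uw

    ∣NA′∣+∣Y∣≤∣NA∣ : ∣ N G A′ ∣ + ∣ Y ∣ ≤ ∣ N G A ∣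
    ∣NA′∣+∣Y∣≤∣NA∣ = ∣p∣+∣q∣≤∣r∣ NA′∩Y≡∅ (N-mono (p─q⊆p A (N G Y))) (p∩q⊆q S _)

    dA′≤dA : ∣ A′ ∣ + ∣ N G A ∣ ≤ ∣ A ∣ + ∣ N G A′ ∣
    dA′≤dA = Equivalence.to (d≤d⇔ A′ A) (critA A′ (Independent-⊆ (p─q⊆p A _) indA))

    ∣Y∣≤∣A─S∣ : ∣ Y ∣ ≤ ∣ A ─ S ∣
    ∣Y∣≤∣A─S∣ = ≤-trans (+-cancelˡ-≤ (∣ A′ ∣ + ∣ N G A′ ∣) _ _ chain) (p⊆q⇒∣p∣≤∣q∣ A∩NY⊆A─S)
      where
      open ≤-Reasoning
      chain : (∣ A′ ∣ + ∣ N G A′ ∣) + ∣ Y ∣ ≤ (∣ A′ ∣ + ∣ N G A′ ∣) + ∣ A ∩ N G Y ∣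
      chain = begin
        (∣ A′ ∣ + ∣ N G A′ ∣) + ∣ Y ∣  ≡⟨ +-assoc ∣ A′ ∣ _ _ ⟩
        ∣ A′ ∣ + (∣ N G A′ ∣ + ∣ Y ∣)  ≤⟨ +-monoʳ-≤ ∣ A′ ∣ ∣NA′∣+∣Y∣≤∣NA∣ ⟩
        ∣ A′ ∣ + ∣ N G A ∣              ≤⟨ dA′≤dA ⟩
        ∣ A ∣ + ∣ N G A′ ∣              ≡⟨ cong (_+ ∣ N G A′ ∣) (∣p∣≡∣p∩q∣+∣p─q∣ A (N G Y)) ⟩
        (∣ A ∩ N G Y ∣ + ∣ A′ ∣) + ∣ N G A′ ∣  ≡⟨ trans (+-assoc ∣ A ∩ N G Y ∣ _ _) (+-comm ∣ A ∩ N G Y ∣ _) ⟩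
        (∣ A′ ∣ + ∣ N G A′ ∣) + ∣ A ∩ N G Y ∣  ∎

    ∣S∣≤∣T∣ : ∣ S ∣ ≤ ∣ T ∣
    ∣S∣≤∣T∣ = begin
      ∣ S ∣                          ≡⟨ ∣p∣≡∣p∩q∣+∣p─q∣ S (N G A) ⟩
      ∣ Y ∣ + ∣ S ─ N G A ∣          ≤⟨ +-monoˡ-≤ ∣ S ─ N G A ∣ ∣Y∣≤∣A─S∣ ⟩
      ∣ A ─ S ∣ + ∣ S ─ N G A ∣      ≤⟨ ∣p∣+∣q∣≤∣r∣ (λ x∈A─S → x∈p─q⇒x∉q A S x∈A─S ∘ p─q⊆p S _)
                                         (p⊆p∪q _ ∘ p─q⊆p A S) (q⊆p∪q A _) ⟩
      ∣ T ∣                          ∎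
      where open ≤-Reasoning

  diadem⊆corona : ∀ {Co D} → IsCorona G Co → IsDiadem G D → D ⊆ Co
  diadem⊆corona corona diadem {v} v∈D with proj₁ (diadem v) v∈D
  ... | A , critA , v∈A = proj₂ (corona v)
    (_ , critical∪maximum─N critA (proj₂ maximumIndependent) , p⊆p∪q _ v∈A)

-- Counting along a matching

matched : List (Fin n × Fin n) → Subset n
matched []            = ⊥
matched ((u , v) ∷ M) = ⁅ u ⁆ ∪ ⁅ v ⁆ ∪ matched M

hits : Subset n → Fin n × Fin n → ℕ
hits p (u , v) = 𝟙[ u ∈ p ] + 𝟙[ v ∈ p ]

hits-⊤ : ∀ (e : Fin n × Fin n) → hits ⊤ e ≡ 2
hits-⊤ (u , v) = cong₂ _+_ (𝟙-∈ {x = u} {p = ⊤} ∈⊤) (𝟙-∈ {x = v} {p = ⊤} ∈⊤)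

hits≡1⇒∈⇒∉ : hits p (x , y) ≡ 1 → x ∈ p → y ∉ p
hits≡1⇒∈⇒∉ hits≡1 x∈p y∈p = contradiction (trans (sym (cong₂ _+_ (𝟙-∈ x∈p) (𝟙-∈ y∈p))) hits≡1) λ ()

hits≡1⇒∉⇒∈ : hits p (x , y) ≡ 1 → x ∉ p → y ∈ p
hits≡1⇒∉⇒∈ {p = p} {y = y} hits≡1 x∉p with y ∈? p
... | yes y∈p = y∈p
... | no  y∉p = contradiction (trans (sym (cong₂ _+_ (𝟙-∉ x∉p) (𝟙-∉ y∉p))) hits≡1) λ ()

module _ (G : Graph n) where

  sum-hits-─⁅⁆ : ∀ p M → All (x ≢_) (endpoints G M) → sum (map (hits (p - x)) M) ≡ sum (map (hits p) M)
  sum-hits-─⁅⁆ p []            []                    = refl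
  sum-hits-─⁅⁆ p ((u , v) ∷ M) (x≢u ∷ x≢v ∷ x∉M) = cong₂ _+_
    (cong₂ _+_ (𝟙[y∈p-x]≡𝟙[y∈p] p x≢u) (𝟙[y∈p-x]≡𝟙[y∈p] p x≢v)) (sum-hits-─⁅⁆ p M x∉M)

  ∣p∣≡sum-hits+∣p─matched∣ : ∀ M → Unique (endpoints G M) → ∀ p →
                             ∣ p ∣ ≡ sum (map (hits p) M) + ∣ p ─ matched M ∣
  ∣p∣≡sum-hits+∣p─matched∣ [] [] p = cong ∣_∣ (sym (p─⊥≡p p))
  ∣p∣≡sum-hits+∣p─matched∣ ((u , v) ∷ M) ((u≢v ∷ u∉M) ∷ v∉M ∷ unique) p = begin
    ∣ p ∣                                            ≡⟨ ∣p∣≡𝟙+∣p-x∣ p u ⟩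
    𝟙[ u ∈ p ] + ∣ p - u ∣                           ≡⟨ cong (𝟙[ u ∈ p ] +_) (∣p∣≡𝟙+∣p-x∣ (p - u) v) ⟩
    𝟙[ u ∈ p ] + (𝟙[ v ∈ p - u ] + ∣ p - u - v ∣)  ≡⟨ cong (λ k → 𝟙[ u ∈ p ] + (k + ∣ p - u - v ∣))
                                                          (𝟙[y∈p-x]≡𝟙[y∈p] p u≢v) ⟩
    𝟙[ u ∈ p ] + (𝟙[ v ∈ p ] + ∣ p - u - v ∣)      ≡⟨ +-assoc 𝟙[ u ∈ p ] _ _ ⟨
    hits p (u , v) + ∣ p - u - v ∣
      ≡⟨ cong (hits p (u , v) +_) (∣p∣≡sum-hits+∣p─matched∣ M unique (p - u - v)) ⟩
    hits p (u , v) + (sum (map (hits (p - u - v)) M) + ∣ p - u - v ─ matched M ∣)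
      ≡⟨ cong (hits p (u , v) +_) (cong₂ _+_ (trans (sum-hits-─⁅⁆ (p - u) M v∉M) (sum-hits-─⁅⁆ p M u∉M))
                                             (cong ∣_∣ p-u-v─matched≡p─matched)) ⟩
    hits p (u , v) + (sum (map (hits p) M) + ∣ p ─ matched ((u , v) ∷ M) ∣)  ≡⟨ +-assoc (hits p (u , v)) _ _ ⟨
    sum (map (hits p) ((u , v) ∷ M)) + ∣ p ─ matched ((u , v) ∷ M) ∣         ∎
    where
    open ≡-Reasoning
    p-u-v─matched≡p─matched : p - u - v ─ matched M ≡ p ─ matched ((u , v) ∷ M)
    p-u-v─matched≡p─matched =
      trans (p─q─r≡p─q∪r (p - u) ⁅ v ⁆ (matched M)) (p─q─r≡p─q∪r p ⁅ u ⁆ (⁅ v ⁆ ∪ matched M))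

-- König–Egerváry graphs

module KönigEgerváry (G : Graph n) {M : List (Fin n × Fin n)} (matching : Matching G M)
                     {α : ℕ} (isα : IsAlpha G α) (α+μ≡n : α + length M ≡ n) where

  private variable
    S : Subset n

  μ : ℕ
  μ = length M

  unmatched : Subset n
  unmatched = ∁ (matched M)

  split-along-M : ∀ p → ∣ p ∣ ≡ sum (map (hits p) M) + ∣ p ─ matched M ∣
  split-along-M = ∣p∣≡sum-hits+∣p─matched∣ G M (proj₂ matching)

  ∣unmatched∣+μ≡α : ∣ unmatched ∣ + μ ≡ α
  ∣unmatched∣+μ≡α = +-cancelʳ-≡ μ _ _ (begin
    (∣ unmatched ∣ + μ) + μ                   ≡⟨ rearrange ∣ unmatched ∣ μ ⟩
    μ * 2 + ∣ unmatched ∣                     ≡⟨ cong₂ _+_ (sum-map-const M (All.universal hits-⊤ M))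
                                                  (cong ∣_∣ (∁q⊆p⇒p─q≡∁q ⊤ (matched M) (λ _ → ∈⊤))) ⟨
    sum (map (hits ⊤) M) + ∣ ⊤ ─ matched M ∣  ≡⟨ trans (sym (split-along-M ⊤)) (∣⊤∣≡n n) ⟩
    n                                         ≡⟨ α+μ≡n ⟨
    α + μ                                     ∎)
    where
    open ≡-Reasoning
    rearrange : ∀ u m → (u + m) + m ≡ m * 2 + u
    rearrange = solve-∀

  private
    S₀ : Subset n
    S₀ = proj₁ isα
    maxS₀ : MaximumIndependent G S₀
    maxS₀ = proj₁ (proj₂ isα)

  ∣maximum∣≡α : MaximumIndependent G S → ∣ S ∣ ≡ α
  ∣maximum∣≡α maxS = trans (∣maximum∣≡∣maximum∣ G maxS maxS₀) (proj₂ (proj₂ isα))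

  p─matched⊆unmatched : ∀ p → p ─ matched M ⊆ unmatched
  p─matched⊆unmatched p = x∉p⇒x∈∁p ∘ x∈p─q⇒x∉q p (matched M)

  independent⇒hits≤1 : Independent G S → All (λ e → hits S e ≤ 1) M
  independent⇒hits≤1 {S} indS = All.map (λ { {u , v} uv → hits≤1 u v uv }) (proj₁ matching)
    where
    hits≤1 : ∀ u v → adj G u v ≡ true → hits S (u , v) ≤ 1
    hits≤1 u v uv with u ∈? S
    ... | yes u∈S = ≤-reflexive (cong₂ _+_ (𝟙-∈ u∈S) (𝟙-∉ λ v∈S → Independent⇒adj≢true G indS u∈S v∈S uv))
    ... | no  u∉S = subst (λ k → k + 𝟙[ v ∈ S ] ≤ 1) (sym (𝟙-∉ u∉S)) 𝟙≤1

  hits≤hits-N : ∀ I → All (λ e → hits I e ≤ hits (N G I) e) M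
  hits≤hits-N I = All.map (λ { {u , v} uv → ≤-trans
      (+-mono-≤ (𝟙-mono λ u∈I → ∈N⁺ G u∈I (trans (adj-sym G v u) uv)) (𝟙-mono λ v∈I → ∈N⁺ G v∈I uv))
      (≤-reflexive (+-comm (𝟙[ v ∈ N G I ]) (𝟙[ u ∈ N G I ]))) })
    (proj₁ matching)

  μ≡sum-1 : μ ≡ sum (map (λ _ → 1) M)
  μ≡sum-1 = sym (trans (sum-map-const M (All.universal (λ _ → refl) M)) (*-identityʳ μ))

  maximum⇒tight : MaximumIndependent G S →
                  sum (map (hits S) M) ≡ μ × ∣ S ─ matched M ∣ ≡ ∣ unmatched ∣
  maximum⇒tight {S} maxS@(indS , _) = m+o≡n+p⇒m≡n×o≡p
    (≤-trans (sum-map-mono M (independent⇒hits≤1 indS)) (≤-reflexive (sym μ≡sum-1)))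
    (p⊆q⇒∣p∣≤∣q∣ (p─matched⊆unmatched S))
    (begin
      sum (map (hits S) M) + ∣ S ─ matched M ∣  ≡⟨ split-along-M S ⟨
      ∣ S ∣                                     ≡⟨ ∣maximum∣≡α maxS ⟩
      α                                         ≡⟨ ∣unmatched∣+μ≡α ⟨
      ∣ unmatched ∣ + μ                         ≡⟨ +-comm ∣ unmatched ∣ μ ⟩
      μ + ∣ unmatched ∣                         ∎)
    where open ≡-Reasoning

  maximum⇒hits≡1 : MaximumIndependent G S → All (λ e → hits S e ≡ 1) M
  maximum⇒hits≡1 maxS@(indS , _) =
    sum-map-≡⇒All-≡ M (independent⇒hits≤1 indS) (trans (proj₁ (maximum⇒tight maxS)) μ≡sum-1)

  unmatched⊆maximum : MaximumIndependent G S → unmatched ⊆ S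
  unmatched⊆maximum {S} maxS = p─q⊆p S (matched M) ∘ ⊆-reflexive (sym
    (p⊆q∧∣q∣≤∣p∣⇒p≡q (p─matched⊆unmatched S) (≤-reflexive (sym (proj₂ (maximum⇒tight maxS))))))

  ∣I∣≤∣NI∣+∣unmatched∣ : ∀ I → ∣ I ∣ ≤ ∣ N G I ∣ + ∣ unmatched ∣
  ∣I∣≤∣NI∣+∣unmatched∣ I = begin
    ∣ I ∣                                         ≡⟨ split-along-M I ⟩
    sum (map (hits I) M) + ∣ I ─ matched M ∣      ≤⟨ +-mono-≤ (sum-map-mono M (hits≤hits-N I))
                                                              (p⊆q⇒∣p∣≤∣q∣ (p─matched⊆unmatched I)) ⟩
    sum (map (hits (N G I)) M) + ∣ unmatched ∣    ≤⟨ +-monoˡ-≤ ∣ unmatched ∣ (≤-trans (m≤m+n _ _)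
                                                       (≤-reflexive (sym (split-along-M (N G I))))) ⟩
    ∣ N G I ∣ + ∣ unmatched ∣                     ∎
    where open ≤-Reasoning

  ∣N[maximum]∣≤μ : MaximumIndependent G S → ∣ N G S ∣ ≤ μ
  ∣N[maximum]∣≤μ {S} maxS@(indS , _) = begin
    ∣ N G S ∣   ≤⟨ p⊆q⇒∣p∣≤∣q∣ (λ v∈NS → x∉p⇒x∈∁p λ v∈S → Independent⇒∉N G indS v∈S v∈NS) ⟩
    ∣ ∁ S ∣     ≡⟨ ∣∁p∣≡n∸∣p∣ S ⟩
    n ∸ ∣ S ∣   ≡⟨ cong₂ _∸_ (sym α+μ≡n) (∣maximum∣≡α maxS) ⟩
    α + μ ∸ α   ≡⟨ m+n∸m≡n α μ ⟩
    μ           ∎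
    where open ≤-Reasoning

  maximum⇒critical : MaximumIndependent G S → CriticalIndependent G S
  maximum⇒critical {S} maxS@(indS , _) = indS , λ I _ → Equivalence.from (d≤d⇔ G I S) (begin
    ∣ I ∣ + ∣ N G S ∣                 ≤⟨ +-mono-≤ (∣I∣≤∣NI∣+∣unmatched∣ I) (∣N[maximum]∣≤μ maxS) ⟩
    (∣ N G I ∣ + ∣ unmatched ∣) + μ   ≡⟨ +-assoc ∣ N G I ∣ _ _ ⟩
    ∣ N G I ∣ + (∣ unmatched ∣ + μ)   ≡⟨ cong (∣ N G I ∣ +_) (trans ∣unmatched∣+μ≡α (sym (∣maximum∣≡α maxS))) ⟩
    ∣ N G I ∣ + ∣ S ∣                 ≡⟨ +-comm (∣ N G I ∣) (∣ S ∣) ⟩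
    ∣ S ∣ + ∣ N G I ∣                 ∎)
    where open ≤-Reasoning

  corona⊆diadem : ∀ {Co D} → IsCorona G Co → IsDiadem G D → Co ⊆ D
  corona⊆diadem corona diadem {v} v∈Co with proj₁ (corona v) v∈Co
  ... | S , maxS , v∈S = proj₂ (diadem v) (S , maximum⇒critical maxS , v∈S)

  ker⊆core : ∀ {K Cr} → IsKer G K → IsCore G Cr → K ⊆ Cr
  ker⊆core ker core {v} v∈K = proj₂ (core v) λ S maxS → proj₁ (ker v) v∈K S (maximum⇒critical maxS)

  module _ {Co Cr : Subset n} (corona : IsCorona G Co) (core : IsCore G Cr) where

    maximum⊆corona : MaximumIndependent G S → S ⊆ Co
    maximum⊆corona maxS {v} v∈S = proj₂ (corona v) (_ , maxS , v∈S)

    core⊆maximum : MaximumIndependent G S → Cr ⊆ S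
    core⊆maximum maxS {v} v∈Cr = proj₁ (core v) v∈Cr _ maxS

    hits-corona+hits-core≡2 : ∀ x y → (∀ {S} → MaximumIndependent G S → hits S (x , y) ≡ 1) →
                              MaximumIndependent G S → x ∈ S → hits Co (x , y) + hits Cr (x , y) ≡ 2
    hits-corona+hits-core≡2 {S} x y once maxS x∈S with y ∈? Co
    ... | yes y∈Co with proj₁ (corona y) y∈Co
    ...   | S′ , maxS′ , y∈S′ = cong₂ _+_
      (cong₂ _+_ (𝟙-∈ (maximum⊆corona maxS x∈S)) (𝟙-∈ y∈Co))
      (cong₂ _+_ (𝟙-∉ λ x∈Cr → hits≡1⇒∈⇒∉ (once maxS′) (core⊆maximum maxS′ x∈Cr) y∈S′) (𝟙-∉ y∉Cr))
      where
      y∉Cr : y ∉ Cr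
      y∉Cr y∈Cr = hits≡1⇒∈⇒∉ (once maxS) x∈S (core⊆maximum maxS y∈Cr)
    hits-corona+hits-core≡2 {S} x y once maxS x∈S | no y∉Co = cong₂ _+_
      (cong₂ _+_ (𝟙-∈ (maximum⊆corona maxS x∈S)) (𝟙-∉ y∉Co))
      (cong₂ _+_ (𝟙-∈ x∈Cr) (𝟙-∉ λ y∈Cr → hits≡1⇒∈⇒∉ (once maxS) x∈S (core⊆maximum maxS y∈Cr)))
      where
      x∈Cr : x ∈ Cr
      x∈Cr = proj₂ (core x) λ S′ maxS′ →
        hits≡1⇒∉⇒∈ (trans (+-comm (𝟙[ y ∈ S′ ]) _) (once maxS′)) (y∉Co ∘ maximum⊆corona maxS′)

    all-hits-corona+hits-core≡2 : All (λ e → hits Co e + hits Cr e ≡ 2) M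
    all-hits-corona+hits-core≡2 = All.tabulate λ { {u , v} e∈M →
      onEdge u v λ maxS → All.lookup (maximum⇒hits≡1 maxS) e∈M }
      where
      onEdge : ∀ u v → (∀ {S} → MaximumIndependent G S → hits S (u , v) ≡ 1) →
               hits Co (u , v) + hits Cr (u , v) ≡ 2
      onEdge u v once with u ∈? S₀
      ... | yes u∈S₀ = hits-corona+hits-core≡2 u v once maxS₀ u∈S₀
      ... | no  u∉S₀ = trans (cong₂ _+_ (+-comm (𝟙[ u ∈ Co ]) _) (+-comm (𝟙[ u ∈ Cr ]) _))
        (hits-corona+hits-core≡2 v u (λ maxS → trans (+-comm (𝟙[ v ∈ _ ]) _) (once maxS))
                                 maxS₀ (hits≡1⇒∉⇒∈ (once maxS₀) u∉S₀))

    unmatched⊆p⇒∣p∣≡sum-hits+∣unmatched∣ : ∀ p → unmatched ⊆ p →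
                                           ∣ p ∣ ≡ sum (map (hits p) M) + ∣ unmatched ∣
    unmatched⊆p⇒∣p∣≡sum-hits+∣unmatched∣ p unmatched⊆p =
      trans (split-along-M p)
            (cong (λ q → sum (map (hits p) M) + ∣ q ∣) (∁q⊆p⇒p─q≡∁q p (matched M) unmatched⊆p))

    unmatched⊆corona : unmatched ⊆ Co
    unmatched⊆corona = maximum⊆corona maxS₀ ∘ unmatched⊆maximum maxS₀

    unmatched⊆core : unmatched ⊆ Cr
    unmatched⊆core v∈U = proj₂ (core _) λ S maxS → unmatched⊆maximum maxS v∈U

    ∣corona∣+∣core∣≡2α : ∣ Co ∣ + ∣ Cr ∣ ≡ 2 * α
    ∣corona∣+∣core∣≡2α = begin
      ∣ Co ∣ + ∣ Cr ∣
        ≡⟨ cong₂ _+_ (unmatched⊆p⇒∣p∣≡sum-hits+∣unmatched∣ Co unmatched⊆corona)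
                     (unmatched⊆p⇒∣p∣≡sum-hits+∣unmatched∣ Cr unmatched⊆core) ⟩
      (sum (map (hits Co) M) + ∣ unmatched ∣) + (sum (map (hits Cr) M) + ∣ unmatched ∣)
        ≡⟨ interchange (sum (map (hits Co) M)) _ _ _ ⟩
      (sum (map (hits Co) M) + sum (map (hits Cr) M)) + (∣ unmatched ∣ + ∣ unmatched ∣)
        ≡⟨ cong (_+ (∣ unmatched ∣ + ∣ unmatched ∣))
                (trans (sym (sum-map-+ M)) (sum-map-const M all-hits-corona+hits-core≡2)) ⟩
      μ * 2 + (∣ unmatched ∣ + ∣ unmatched ∣)
        ≡⟨ rearrange μ ∣ unmatched ∣ ⟩
      2 * (∣ unmatched ∣ + μ)
        ≡⟨ cong (2 *_) ∣unmatched∣+μ≡α ⟩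
      2 * α ∎
      where
      open ≡-Reasoning
      rearrange : ∀ m u → m * 2 + (u + u) ≡ 2 * (u + m)
      rearrange = solve-∀

mainTheorem5 : (∀ {n} (G : Graph n) → KonigEgervary G →
    ∀ (a : ℕ) (Cr Co K D : Subset n) → IsAlpha G a →
    IsCore G Cr → IsCorona G Co → IsKer G K → IsDiadem G D →
    (∣ Co ∣ + ∣ Cr ∣ ≡ 2 * a) × (D ≡ Co) × (∣ K ∣ + ∣ D ∣ ≤ 2 * a))
    × (∀ {m} (H : Graph m) (Co D : Subset m) →
    IsCorona H Co → IsDiadem H D → D ⊆ Co)
mainTheorem5 .proj₂ H Co D = diadem⊆corona H
mainTheorem5 .proj₁ G (a′ , _ , (S′ , maxS′ , ∣S′∣≡a′) , (M , matching , refl , _) , a′+μ≡n)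
                    a Cr Co K D isα@(S , maxS , ∣S∣≡a) core corona ker diadem =
  ∣corona∣+∣core∣≡2α corona core , D≡Co , ∣K∣+∣D∣≤2a
  where
  a≡a′ : a ≡ a′
  a≡a′ = trans (sym ∣S∣≡a) (trans (∣maximum∣≡∣maximum∣ G maxS maxS′) ∣S′∣≡a′)

  open KönigEgerváry G matching isα (subst (λ k → k + length M ≡ _) (sym a≡a′) a′+μ≡n)

  D≡Co : D ≡ Co
  D≡Co = ⊆-antisym (diadem⊆corona G corona diadem) (corona⊆diadem corona diadem)

  ∣K∣+∣D∣≤2a : ∣ K ∣ + ∣ D ∣ ≤ 2 * a
  ∣K∣+∣D∣≤2a = begin
    ∣ K ∣ + ∣ D ∣    ≤⟨ +-monoˡ-≤ ∣ D ∣ (p⊆q⇒∣p∣≤∣q∣ (ker⊆core ker core)) ⟩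
    ∣ Cr ∣ + ∣ D ∣   ≡⟨ cong (λ X → ∣ Cr ∣ + ∣ X ∣) D≡Co ⟩
    ∣ Cr ∣ + ∣ Co ∣  ≡⟨ +-comm (∣ Cr ∣) (∣ Co ∣) ⟩
    ∣ Co ∣ + ∣ Cr ∣  ≡⟨ ∣corona∣+∣core∣≡2α corona core ⟩
    2 * a            ∎
    where open ≤-Reasoning
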